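{- Let $1\leqslant p\leqslant q$ be integers and let $K_{p,q}$ be the complete bipartite graph with parts of sizes $p$ and $q$. Then (i) $\phi_{\max}(K_{p,q})=p\binom{q}{2}=\tfrac12 p(q^2-q)$ and (ii) $\phi_{\min}(K_{p,q})=\tfrac16(3q-p-1)(p^2-p)$.
   Context: All graphs are finite, simple and undirected. A numbering of a graph $G$ with $n$ vertices is a bijection $\pi:V(G)\to\{1,\dots,n\}$. A 2-path $\langle x,u,y\rangle$ of $G$ consists of a middle vertex $u$ and an unordered pair $\{x,y\}$ of two distinct neighbours of $u$. Given a numbering $\pi$, the 2-path $\langle x,u,y\rangle$ is valid if $\pi(u)<\min(\pi(x),\pi(y))$. The validity $\phi_\pi(G)$ is the number of valid 2-paths of $G$ under $\pi$; $\phi_{\min}(G)$ and $\phi_{\max}(G)$ are the minimum and maximum of $\phi_\pi(G)$ over all numberings $\pi$ of $G$. -}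

module Defs where

open import Data.Nat using (ℕ; zero; suc; _+_; _*_; _≤_; _<ᵇ_)
open import Data.Bool using (Bool; true; false; _∧_; _xor_; if_then_else_)
open import Data.Fin using (Fin; zero; suc; toℕ)
open import Data.Fin.Permutation using (Permutation′; _⟨$⟩ʳ_)
open import Data.Product using (Σ; _×_)
open import Relation.Binary.PropositionalEquality using (_≡_)

record Graph (n : ℕ) : Set where
  field
    adj   : Fin n → Fin n → Bool
    sym   : ∀ i j → adj i j ≡ adj j i
    irrefl : ∀ i → adj i i ≡ false
open Graph public

ΣFin : (n : ℕ) → (Fin n → ℕ) → ℕ
ΣFin zero    f = 0
ΣFin (suc n) f = f zero + ΣFin n (λ i → f (suc i))

-- A numbering is a bijection V(G) → {1..n}; we use Fin n = {0..n-1},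
-- which induces the same order comparisons.
Numbering : ℕ → Set
Numbering n = Permutation′ n

_<ꟳ_ : ∀ {n} → Fin n → Fin n → Bool
i <ꟳ j = toℕ i <ᵇ toℕ j

-- indicator that 2-path ⟨x,u,y⟩ (with x before y as vertices, so each
-- unordered pair {x,y} counted once) exists and is valid under π
validInd : ∀ {n} → Graph n → Numbering n → Fin n → Fin n → Fin n → ℕ
validInd G π u x y =
  if (x <ꟳ y) ∧ adj G u x ∧ adj G u y
       ∧ ((π ⟨$⟩ʳ u) <ꟳ (π ⟨$⟩ʳ x)) ∧ ((π ⟨$⟩ʳ u) <ꟳ (π ⟨$⟩ʳ y))
  then 1 else 0

validity : ∀ {n} → Graph n → Numbering n → ℕ
validity {n} G π =
  ΣFin n λ u → ΣFin n λ x → ΣFin n λ y → validInd G π u x y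

IsPhiMax : ∀ {n} → Graph n → ℕ → Set
IsPhiMax {n} G m = Σ (Numbering n) (λ π → validity G π ≡ m)
                   × (∀ (π : Numbering n) → validity G π ≤ m)

IsPhiMin : ∀ {n} → Graph n → ℕ → Set
IsPhiMin {n} G m = Σ (Numbering n) (λ π → validity G π ≡ m)
                   × (∀ (π : Numbering n) → m ≤ validity G π)

inA : ∀ {n} → ℕ → Fin n → Bool
inA p i = toℕ i <ᵇ p

completeBipartite : (p q : ℕ) → Graph (p + q)
completeBipartite p q = record
  { adj = λ i j → inA p i xor inA p j
  ; sym = λ i j → xor-comm (inA p i) (inA p j)
  ; irrefl = λ i → xor-self (inA p i)
  }
  where
  xor-comm : ∀ a b → (a xor b) ≡ (b xor a)
  xor-comm true true = _≡_.refl
  xor-comm true false = _≡_.refl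
  xor-comm false true = _≡_.refl
  xor-comm false false = _≡_.refl
  xor-self : ∀ a → (a xor a) ≡ false
  xor-self true = _≡_.refl
  xor-self false = _≡_.refl

-- Read a numbering of K_{p,q} as the word whose k-th letter says which part the vertex numbered k lies
-- in. That vertex is the middle of C(r,2) valid 2-paths, r being the number of later letters of the other
-- kind, so φ_π depends only on the word. For a word with a letters of one kind and b of the other,
-- induction on its length bounds φ above by min(a,b)·C(max(a,b),2) and 6φ below by m(m-1)(3M-m-1),
-- m = min(a,b), M = max(a,b): prepending a letter raises the first bound by at least that letter's
-- contribution and the second by at most six times it. The bounds are attained by T^p F^q and by
-- F^(q-p) (TF)^p.
module Submission where

open import Defs
open import Data.Bool using (Bool; true; false; not; _∧_; _xor_; if_then_else_)
open import Data.Bool.Properties using (∧-assoc; ∧-zeroʳ; ∧-comm; ∧-commutativeMonoid)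
open import Data.Fin using (Fin; zero; suc; toℕ; punchIn; fromℕ<)
open import Data.Fin.Properties using (toℕ-fromℕ<)
open import Data.Fin.Permutation
  using (Permutation′; _⟨$⟩ʳ_; _⟨$⟩ˡ_; flip; insert; insert-punchIn; inverseʳ)
  renaming (id to idₚ)
open import Data.Nat using (ℕ; zero; suc; _+_; _*_; _∸_; _/_; _≤_; _⊓_; _⊔_; ∣_-_∣; z≤n; s≤s)
open import Data.Nat.Properties
open import Data.Nat.Combinatorics using (_C_; nC1≡n; nCk+nC[k+1]≡[n+1]C[k+1])
open import Data.Nat.DivMod using (m*n/n≡m)
open import Data.Nat.Tactic.RingSolver using (solve-∀)
open import Data.Product using (Σ; _×_; _,_)
open import Data.Vec.Functional using (Vector; []; _∷_; tail)
open import Function using (_∘_)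
open import Relation.Binary.PropositionalEquality as ≡
  using (_≡_; refl; cong; cong₂; trans; subst; module ≡-Reasoning)
open import Algebra.Bundles using (CommutativeMonoid)
open import Algebra.Properties.CommutativeMonoid.Sum +-0-commutativeMonoid using (sum; sum-permute)
open import Algebra.Properties.CommutativeSemigroup
  (CommutativeMonoid.commutativeSemigroup ∧-commutativeMonoid) using (interchange)

𝟙 : Bool → ℕ
𝟙 b = if b then 1 else 0

count : ∀ {n} → (Fin n → Bool) → ℕ
count {n} P = ΣFin n (𝟙 ∘ P)

ΣFin-cong : ∀ {n} {f g : Fin n → ℕ} → (∀ i → f i ≡ g i) → ΣFin n f ≡ ΣFin n g
ΣFin-cong {zero}  f≗g = refl
ΣFin-cong {suc n} f≗g = cong₂ _+_ (f≗g zero) (ΣFin-cong (f≗g ∘ suc))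

ΣFin≡sum : ∀ {n} (f : Fin n → ℕ) → ΣFin n f ≡ sum f
ΣFin≡sum {zero}  f = refl
ΣFin≡sum {suc n} f = cong (f zero +_) (ΣFin≡sum (f ∘ suc))

ΣFin-permute : ∀ {n} (σ : Permutation′ n) (f : Fin n → ℕ) →
  ΣFin n f ≡ ΣFin n (f ∘ (σ ⟨$⟩ʳ_))
ΣFin-permute σ f =
  trans (ΣFin≡sum f) (trans (sum-permute f σ) (≡.sym (ΣFin≡sum (f ∘ (σ ⟨$⟩ʳ_)))))

count-cong : ∀ {n} {P Q : Fin n → Bool} → (∀ i → P i ≡ Q i) → count P ≡ count Q
count-cong P≗Q = ΣFin-cong (cong 𝟙 ∘ P≗Q)

count-permute : ∀ {n} (σ : Permutation′ n) (P : Fin n → Bool) →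
  count P ≡ count (P ∘ (σ ⟨$⟩ʳ_))
count-permute σ P = ΣFin-permute σ (𝟙 ∘ P)

count-false : ∀ n → count {n} (λ _ → false) ≡ 0
count-false zero    = refl
count-false (suc n) = count-false n

count-true : ∀ n → count {n} (λ _ → true) ≡ n
count-true zero    = refl
count-true (suc n) = cong suc (count-true n)

count≤length : ∀ {n} (P : Fin n → Bool) → count P ≤ n
count≤length {zero}  P = z≤n
count≤length {suc n} P = +-mono-≤ (𝟙≤1 (P zero)) (count≤length (P ∘ suc))
  where
  𝟙≤1 : ∀ b → 𝟙 b ≤ 1
  𝟙≤1 true  = s≤s z≤n
  𝟙≤1 false = z≤n

choose2 : ℕ → ℕ
choose2 zero    = 0
choose2 (suc n) = n + choose2 n

choose2≡C2 : ∀ n → choose2 n ≡ n C 2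
choose2≡C2 zero    = refl
choose2≡C2 (suc n) =
  trans (cong₂ _+_ (≡.sym (nC1≡n n)) (choose2≡C2 n)) (nCk+nC[k+1]≡[n+1]C[k+1] n 1)

choose2-double : ∀ n → 2 * choose2 (suc n) ≡ suc n * n
choose2-double zero    = refl
choose2-double (suc n) = begin
  2 * (suc n + choose2 (suc n))    ≡⟨ *-distribˡ-+ 2 (suc n) _ ⟩
  2 * suc n + 2 * choose2 (suc n)  ≡⟨ cong (2 * suc n +_) (choose2-double n) ⟩
  2 * suc n + suc n * n            ≡⟨ ring n ⟩
  suc (suc n) * suc n              ∎
  where
  open ≡-Reasoning
  ring : ∀ n → 2 * suc n + suc n * n ≡ suc (suc n) * suc n
  ring = solve-∀

choose2-square : ∀ n → 2 * choose2 n + n ≡ n * n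
choose2-square zero    = refl
choose2-square (suc n) = trans (cong (_+ suc n) (choose2-double n)) (ring n)
  where
  ring : ∀ n → suc n * n + suc n ≡ suc n * suc n
  ring = solve-∀

choose2≤square : ∀ n → choose2 n ≤ n * n
choose2≤square n = subst (choose2 n ≤_) (choose2-square n)
  (≤-trans (m≤n*m (choose2 n) 2) (m≤m+n (2 * choose2 n) n))

six-choose2 : ∀ n → 6 * choose2 (suc n) ≡ 3 * (suc n * n)
six-choose2 n = trans (*-assoc 3 2 (choose2 (suc n))) (cong (3 *_) (choose2-double n))

count-pairs : ∀ {n} (P : Fin n → Bool) →
  ΣFin n (λ x → ΣFin n (λ y → 𝟙 ((x <ꟳ y) ∧ P x ∧ P y))) ≡ choose2 (count P)
count-pairs {zero}  P = refl
count-pairs {suc n} P with P zero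
... | true  = cong (count (P ∘ suc) +_) (count-pairs (P ∘ suc))
... | false = cong₂ _+_ (count-false n) (count-pairs (P ∘ suc))

validity-byMiddle : ∀ {n} (G : Graph n) (π : Numbering n) →
  validity G π ≡ ΣFin n (λ u → choose2 (count λ x → adj G u x ∧ (π ⟨$⟩ʳ u) <ꟳ (π ⟨$⟩ʳ x)))
validity-byMiddle G π = ΣFin-cong λ u →
  trans (ΣFin-cong λ x → ΣFin-cong λ y → cong 𝟙
          (regroup (x <ꟳ y) (adj G u x) (adj G u y) ((π ⟨$⟩ʳ u) <ꟳ (π ⟨$⟩ʳ x)) ((π ⟨$⟩ʳ u) <ꟳ (π ⟨$⟩ʳ y))))
        (count-pairs λ x → adj G u x ∧ (π ⟨$⟩ʳ u) <ꟳ (π ⟨$⟩ʳ x))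
  where
  regroup : ∀ a b c d e → (a ∧ b ∧ c ∧ d ∧ e) ≡ (a ∧ (b ∧ d) ∧ (c ∧ e))
  regroup a b c d e = cong (a ∧_) (trans (≡.sym (∧-assoc b c (d ∧ e))) (interchange b c d e))

validity-byPosition : ∀ {n} (G : Graph n) (π : Numbering n) →
  validity G π ≡ ΣFin n (λ k → choose2 (count λ j → (k <ꟳ j) ∧ adj G (π ⟨$⟩ˡ k) (π ⟨$⟩ˡ j)))
validity-byPosition G π = begin
  validity G π
    ≡⟨ validity-byMiddle G π ⟩
  ΣFin _ (λ u → choose2 (count λ x → adj G u x ∧ (π ⟨$⟩ʳ u) <ꟳ (π ⟨$⟩ʳ x)))
    ≡⟨ ΣFin-permute (flip π) _ ⟩
  ΣFin _ (λ k → choose2 (count λ x → adj G (π ⟨$⟩ˡ k) x ∧ (π ⟨$⟩ʳ (π ⟨$⟩ˡ k)) <ꟳ (π ⟨$⟩ʳ x)))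
    ≡⟨ ΣFin-cong (λ k → cong choose2 (trans (count-permute (flip π) _) (count-cong (reorder k)))) ⟩
  ΣFin _ (λ k → choose2 (count λ j → (k <ꟳ j) ∧ adj G (π ⟨$⟩ˡ k) (π ⟨$⟩ˡ j))) ∎
  where
  open ≡-Reasoning
  reorder : ∀ k j →
    (adj G (π ⟨$⟩ˡ k) (π ⟨$⟩ˡ j) ∧ (π ⟨$⟩ʳ (π ⟨$⟩ˡ k)) <ꟳ (π ⟨$⟩ʳ (π ⟨$⟩ˡ j)))
      ≡ ((k <ꟳ j) ∧ adj G (π ⟨$⟩ˡ k) (π ⟨$⟩ˡ j))
  reorder k j = trans
    (cong₂ (λ a b → adj G (π ⟨$⟩ˡ k) (π ⟨$⟩ˡ j) ∧ a <ꟳ b) (inverseʳ π) (inverseʳ π))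
    (∧-comm _ (k <ꟳ j))

Word : ℕ → Set
Word = Vector Bool

wordValidity : ∀ {n} → Word n → ℕ
wordValidity {n} w = ΣFin n λ k → choose2 (count λ j → (k <ꟳ j) ∧ (w k xor w j))

wordValidity-cong : ∀ {n} {v w : Word n} → (∀ k → v k ≡ w k) → wordValidity v ≡ wordValidity w
wordValidity-cong v≗w = ΣFin-cong λ k → cong choose2 (count-cong λ j →
  cong (λ b → (k <ꟳ j) ∧ b) (cong₂ _xor_ (v≗w k) (v≗w j)))

upperBound : ℕ → ℕ → ℕ
upperBound a b = (a ⊓ b) * choose2 (a ⊔ b)

upperBound-≤ : ∀ {a b} → a ≤ b → upperBound a b ≡ a * choose2 b
upperBound-≤ a≤b = cong₂ (λ m M → m * choose2 M) (m≤n⇒m⊓n≡m a≤b) (m≤n⇒m⊔n≡n a≤b)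

upperBound-≥ : ∀ {a b} → b ≤ a → upperBound a b ≡ b * choose2 a
upperBound-≥ b≤a = cong₂ (λ m M → m * choose2 M) (m≥n⇒m⊓n≡n b≤a) (m≥n⇒m⊔n≡m b≤a)

upperBound-comm : ∀ a b → upperBound a b ≡ upperBound b a
upperBound-comm a b = cong₂ (λ m M → m * choose2 M) (⊓-comm a b) (⊔-comm a b)

-- Six times φ_min(K_{m,m+d}), i.e. m(m-1)(2m-1+3d), written without truncated subtraction.
sixφmin : ℕ → ℕ → ℕ
sixφmin zero    d = 0
sixφmin (suc m) d = suc m * m * suc (2 * m + 3 * d)

sixφmin-sucʳ : ∀ m d → sixφmin m (suc d) ≡ 6 * choose2 m + sixφmin m d
sixφmin-sucʳ zero    d = refl
sixφmin-sucʳ (suc m) d = trans (ring m d) (cong (_+ sixφmin (suc m) d) (≡.sym (six-choose2 m)))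
  where
  ring : ∀ m d → suc m * m * suc (2 * m + 3 * suc d)
                   ≡ 3 * (suc m * m) + suc m * m * suc (2 * m + 3 * d)
  ring = solve-∀

sixφmin-sucˡ : ∀ m d →
  sixφmin (suc m) d + 3 * d * suc d ≡ 6 * choose2 (suc (m + d)) + sixφmin m (suc d)
sixφmin-sucˡ zero    d = trans (ring d) (cong (_+ 0) (≡.sym (six-choose2 d)))
  where
  ring : ∀ d → 3 * d * suc d ≡ 3 * (suc d * d) + 0
  ring = solve-∀
sixφmin-sucˡ (suc m) d =
  trans (ring m d) (cong (_+ sixφmin (suc m) (suc d)) (≡.sym (six-choose2 (suc m + d))))
  where
  ring : ∀ m d → suc (suc m) * suc m * suc (2 * suc m + 3 * d) + 3 * d * suc d
                   ≡ 3 * (suc (suc m + d) * (suc m + d)) + suc m * m * suc (2 * m + 3 * suc d)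
  ring = solve-∀

lowerBound : ℕ → ℕ → ℕ
lowerBound a b = sixφmin (a ⊓ b) ∣ a - b ∣

lowerBound-+ : ∀ a d → lowerBound a (a + d) ≡ sixφmin a d
lowerBound-+ a d = cong₂ sixφmin (m≤n⇒m⊓n≡m (m≤m+n a d)) (∣m-m+n∣≡n a d)

lowerBound-comm : ∀ a b → lowerBound a b ≡ lowerBound b a
lowerBound-comm a b = cong₂ sixφmin (⊓-comm a b) (∣-∣-comm a b)

lowerBound-suc+ : ∀ a d → lowerBound a (suc (a + d)) ≡ sixφmin a (suc d)
lowerBound-suc+ a d = trans (cong (lowerBound a) (≡.sym (+-suc a d))) (lowerBound-+ a (suc d))

data Order : ℕ → ℕ → Set where
  below : ∀ a d → Order a (suc (a + d))
  above : ∀ b d → Order (b + d) b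

order : ∀ a b → Order a b
order zero    zero    = above 0 0
order zero    (suc b) = below 0 b
order (suc a) zero    = above 0 (suc a)
order (suc a) (suc b) with order a b
... | below a d = below (suc a) d
... | above b d = above (suc b) d

upperBound-sucˡ : ∀ a b → choose2 b + upperBound a b ≤ upperBound (suc a) b
upperBound-sucˡ a b with order a b
... | below a d = ≤-reflexive (trans
  (cong (choose2 (suc (a + d)) +_) (upperBound-≤ (m≤n⇒m≤1+n (m≤m+n a d))))
  (≡.sym (upperBound-≤ (s≤s (m≤m+n a d)))))
... | above b d = begin
  choose2 b + upperBound (b + d) b      ≡⟨ cong (choose2 b +_) (upperBound-≥ (m≤m+n b d)) ⟩
  choose2 b + b * choose2 (b + d)       ≤⟨ +-monoˡ-≤ _ choose2b≤b[b+d] ⟩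
  b * (b + d) + b * choose2 (b + d)     ≡⟨ ≡.sym (*-distribˡ-+ b (b + d) _) ⟩
  b * choose2 (suc (b + d))             ≡⟨ ≡.sym (upperBound-≥ (m≤n⇒m≤1+n (m≤m+n b d))) ⟩
  upperBound (suc (b + d)) b            ∎
  where
  open ≤-Reasoning
  choose2b≤b[b+d] : choose2 b ≤ b * (b + d)
  choose2b≤b[b+d] = ≤-trans (choose2≤square b) (*-monoʳ-≤ b (m≤m+n b d))

upperBound-sucʳ : ∀ a b → choose2 a + upperBound a b ≤ upperBound a (suc b)
upperBound-sucʳ a b = begin
  choose2 a + upperBound a b  ≡⟨ cong (choose2 a +_) (upperBound-comm a b) ⟩
  choose2 a + upperBound b a  ≤⟨ upperBound-sucˡ b a ⟩
  upperBound (suc b) a        ≡⟨ upperBound-comm (suc b) a ⟩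
  upperBound a (suc b)        ∎
  where open ≤-Reasoning

lowerBound-sucˡ : ∀ a b → lowerBound (suc a) b ≤ 6 * choose2 b + lowerBound a b
lowerBound-sucˡ a b with order a b
... | below a d = begin
  lowerBound (suc a) (suc (a + d))
    ≡⟨ lowerBound-+ (suc a) d ⟩
  sixφmin (suc a) d
    ≤⟨ m≤m+n (sixφmin (suc a) d) (3 * d * suc d) ⟩
  sixφmin (suc a) d + 3 * d * suc d
    ≡⟨ sixφmin-sucˡ a d ⟩
  6 * choose2 (suc (a + d)) + sixφmin a (suc d)
    ≡⟨ cong (6 * choose2 (suc (a + d)) +_) (≡.sym (lowerBound-suc+ a d)) ⟩
  6 * choose2 (suc (a + d)) + lowerBound a (suc (a + d)) ∎
  where open ≤-Reasoning
... | above b d = ≤-reflexive (begin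
  lowerBound (suc (b + d)) b       ≡⟨ lowerBound-comm (suc (b + d)) b ⟩
  lowerBound b (suc (b + d))       ≡⟨ lowerBound-suc+ b d ⟩
  sixφmin b (suc d)                ≡⟨ sixφmin-sucʳ b d ⟩
  6 * choose2 b + sixφmin b d      ≡⟨ cong (6 * choose2 b +_) (≡.sym (lowerBound-+ b d)) ⟩
  6 * choose2 b + lowerBound b (b + d)  ≡⟨ cong (6 * choose2 b +_) (lowerBound-comm b (b + d)) ⟩
  6 * choose2 b + lowerBound (b + d) b  ∎)
  where open ≡-Reasoning

lowerBound-sucʳ : ∀ a b → lowerBound a (suc b) ≤ 6 * choose2 a + lowerBound a b
lowerBound-sucʳ a b = begin
  lowerBound a (suc b)         ≡⟨ lowerBound-comm a (suc b) ⟩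
  lowerBound (suc b) a         ≤⟨ lowerBound-sucˡ b a ⟩
  6 * choose2 a + lowerBound b a  ≡⟨ cong (6 * choose2 a +_) (lowerBound-comm b a) ⟩
  6 * choose2 a + lowerBound a b  ∎
  where open ≤-Reasoning

wordValidity≤upperBound : ∀ {n} (w : Word n) →
  wordValidity w ≤ upperBound (count w) (count (not ∘ w))
wordValidity≤upperBound {zero}  w = z≤n
wordValidity≤upperBound {suc n} w = prepend (w zero) (wordValidity≤upperBound (tail w))
  where
  a = count (tail w)
  b = count (not ∘ tail w)
  prepend : ∀ x → wordValidity (tail w) ≤ upperBound a b →
    choose2 (count λ j → x xor w (suc j)) + wordValidity (tail w)
      ≤ upperBound (𝟙 x + a) (𝟙 (not x) + b)
  prepend true  ih = ≤-trans (+-monoʳ-≤ (choose2 b) ih) (upperBound-sucˡ a b)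
  prepend false ih = ≤-trans (+-monoʳ-≤ (choose2 a) ih) (upperBound-sucʳ a b)

lowerBound≤wordValidity : ∀ {n} (w : Word n) →
  lowerBound (count w) (count (not ∘ w)) ≤ 6 * wordValidity w
lowerBound≤wordValidity {zero}  w = z≤n
lowerBound≤wordValidity {suc n} w = prepend (w zero) (lowerBound≤wordValidity (tail w))
  where
  a = count (tail w)
  b = count (not ∘ tail w)
  Φ = wordValidity (tail w)
  prepend : ∀ x → lowerBound a b ≤ 6 * Φ →
    lowerBound (𝟙 x + a) (𝟙 (not x) + b) ≤ 6 * (choose2 (count λ j → x xor w (suc j)) + Φ)
  prepend true ih = begin
    lowerBound (suc a) b         ≤⟨ lowerBound-sucˡ a b ⟩
    6 * choose2 b + lowerBound a b  ≤⟨ +-monoʳ-≤ (6 * choose2 b) ih ⟩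
    6 * choose2 b + 6 * Φ        ≡⟨ ≡.sym (*-distribˡ-+ 6 (choose2 b) Φ) ⟩
    6 * (choose2 b + Φ)          ∎
    where open ≤-Reasoning
  prepend false ih = begin
    lowerBound a (suc b)         ≤⟨ lowerBound-sucʳ a b ⟩
    6 * choose2 a + lowerBound a b  ≤⟨ +-monoʳ-≤ (6 * choose2 a) ih ⟩
    6 * choose2 a + 6 * Φ        ≡⟨ ≡.sym (*-distribˡ-+ 6 (choose2 a) Φ) ⟩
    6 * (choose2 a + Φ)          ∎
    where open ≤-Reasoning

count-inA : ∀ p q → count {p + q} (inA p) ≡ p
count-inA zero    q = count-false q
count-inA (suc p) q = cong suc (count-inA p q)

count-not-inA : ∀ p q → count {p + q} (not ∘ inA p) ≡ q
count-not-inA zero    q = count-true q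
count-not-inA (suc p) q = count-not-inA p q

wordValidity-inA : ∀ p q → wordValidity {p + q} (inA p) ≡ p * choose2 q
wordValidity-inA zero    q = trans
  (ΣFin-cong {q} λ k → cong choose2 (trans (count-cong {q} λ j → ∧-zeroʳ (k <ꟳ j)) (count-false q)))
  (count-false q)
wordValidity-inA (suc p) q = cong₂ _+_ (cong choose2 (count-not-inA p q)) (wordValidity-inA p q)

minimiser : ∀ m d → Word (d + m * 2)
minimiser m       (suc d) = false ∷ minimiser m d
minimiser zero    zero    = []
minimiser (suc m) zero    = true ∷ false ∷ minimiser m zero

length-minimiser : ∀ m d → d + m * 2 ≡ m + (m + d)
length-minimiser m d = ring d m
  where
  ring : ∀ d m → d + m * 2 ≡ m + (m + d)
  ring = solve-∀

count-minimiser : ∀ m d → count (minimiser m d) ≡ m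
count-minimiser m       (suc d) = count-minimiser m d
count-minimiser zero    zero    = refl
count-minimiser (suc m) zero    = cong suc (count-minimiser m zero)

count-not-minimiser : ∀ m d → count (not ∘ minimiser m d) ≡ m + d
count-not-minimiser m       (suc d) = trans (cong suc (count-not-minimiser m d)) (≡.sym (+-suc m d))
count-not-minimiser zero    zero    = refl
count-not-minimiser (suc m) zero    = cong suc (count-not-minimiser m zero)

wordValidity-minimiser : ∀ m d → 6 * wordValidity (minimiser m d) ≡ sixφmin m d
wordValidity-minimiser m (suc d) = begin
  6 * (choose2 (count w) + wordValidity w)      ≡⟨ *-distribˡ-+ 6 (choose2 (count w)) _ ⟩
  6 * choose2 (count w) + 6 * wordValidity w    ≡⟨ cong₂ (λ c v → 6 * choose2 c + v)
                                                         (count-minimiser m d) (wordValidity-minimiser m d) ⟩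
  6 * choose2 m + sixφmin m d                   ≡⟨ ≡.sym (sixφmin-sucʳ m d) ⟩
  sixφmin m (suc d)                             ∎
  where
  open ≡-Reasoning
  w = minimiser m d
wordValidity-minimiser zero zero = refl
wordValidity-minimiser (suc m) zero = begin
  6 * (choose2 (suc f) + (choose2 t + wordValidity w))
    ≡⟨ *-distribˡ-+ 6 (choose2 (suc f)) (choose2 t + wordValidity w) ⟩
  6 * choose2 (suc f) + 6 * (choose2 t + wordValidity w)
    ≡⟨ cong (6 * choose2 (suc f) +_) (*-distribˡ-+ 6 (choose2 t) (wordValidity w)) ⟩
  6 * choose2 (suc f) + (6 * choose2 t + 6 * wordValidity w)
    ≡⟨ cong₂ (λ c rest → 6 * choose2 (suc c) + rest) (count-not-minimiser m zero)
             (cong₂ (λ c v → 6 * choose2 c + v) (count-minimiser m zero) (wordValidity-minimiser m zero)) ⟩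
  6 * choose2 (suc (m + 0)) + (6 * choose2 m + sixφmin m 0)
    ≡⟨ cong (6 * choose2 (suc (m + 0)) +_) (≡.sym (sixφmin-sucʳ m 0)) ⟩
  6 * choose2 (suc (m + 0)) + sixφmin m 1
    ≡⟨ ≡.sym (sixφmin-sucˡ m 0) ⟩
  sixφmin (suc m) 0 + 0
    ≡⟨ +-identityʳ _ ⟩
  sixφmin (suc m) 0 ∎
  where
  open ≡-Reasoning
  w = minimiser m zero
  t = count w
  f = count (not ∘ w)

Sorts : ∀ {n} → Word n → Permutation′ n → Set
Sorts w σ = ∀ k → inA (count w) (σ ⟨$⟩ʳ k) ≡ w k

inA-self : ∀ {n} (i : Fin n) → inA (toℕ i) i ≡ false
inA-self zero    = refl
inA-self (suc i) = inA-self i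

inA-punchIn : ∀ {n} (i : Fin (suc n)) (v : Fin n) → inA (toℕ i) (punchIn i v) ≡ inA (toℕ i) v
inA-punchIn zero    v       = refl
inA-punchIn (suc i) zero    = refl
inA-punchIn (suc i) (suc v) = inA-punchIn i v

sorting-∷ : ∀ {n} x (w : Word n) → Σ (Permutation′ n) (Sorts w) →
  Σ (Permutation′ (suc n)) (Sorts (x ∷ w))
sorting-∷ true w (σ , sorts) = insert zero zero σ , sorts′
  where
  sorts′ : Sorts (true ∷ w) (insert zero zero σ)
  sorts′ zero    = refl
  sorts′ (suc k) = trans (cong (inA (suc (count w))) (insert-punchIn zero zero σ k)) (sorts k)
sorting-∷ false w (σ , sorts) = insert zero j σ , sorts′
  where
  j = fromℕ< (s≤s (count≤length w))
  toℕj≡count : toℕ j ≡ count w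
  toℕj≡count = toℕ-fromℕ< (s≤s (count≤length w))
  inA-punchIn-j : ∀ v → inA (count w) (punchIn j v) ≡ inA (count w) v
  inA-punchIn-j v = subst (λ c → inA c (punchIn j v) ≡ inA c v) toℕj≡count (inA-punchIn j v)
  sorts′ : Sorts (false ∷ w) (insert zero j σ)
  sorts′ zero    = subst (λ c → inA c j ≡ false) toℕj≡count (inA-self j)
  sorts′ (suc k) = begin
    inA (count w) (insert zero j σ ⟨$⟩ʳ suc k)  ≡⟨ cong (inA (count w)) (insert-punchIn zero j σ k) ⟩
    inA (count w) (punchIn j (σ ⟨$⟩ʳ k))        ≡⟨ inA-punchIn-j (σ ⟨$⟩ʳ k) ⟩
    inA (count w) (σ ⟨$⟩ʳ k)                    ≡⟨ sorts k ⟩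
    w k                                         ∎
    where open ≡-Reasoning

sorting : ∀ {n} (w : Word n) → Σ (Permutation′ n) (Sorts w)
sorting {zero}  w = idₚ , λ ()
sorting {suc n} w with sorting-∷ (w zero) (tail w) (sorting (tail w))
... | σ , sorts = σ , λ { zero → sorts zero ; (suc k) → sorts (suc k) }

partWord : ∀ p {q} → Numbering (p + q) → Word (p + q)
partWord p π k = inA p (π ⟨$⟩ˡ k)

validity-completeBipartite : ∀ p q (π : Numbering (p + q)) →
  validity (completeBipartite p q) π ≡ wordValidity (partWord p π)
validity-completeBipartite p q π = validity-byPosition (completeBipartite p q) π

count-partWord : ∀ p q (π : Numbering (p + q)) →
  count (partWord p π) ≡ p × count (not ∘ partWord p π) ≡ q
count-partWord p q π =
  trans (≡.sym (count-permute (flip π) (inA p))) (count-inA p q) ,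
  trans (≡.sym (count-permute (flip π) (not ∘ inA p))) (count-not-inA p q)

numberingWithWord : ∀ p q {n} (w : Word n) → n ≡ p + q → count w ≡ p →
  Σ (Numbering (p + q)) λ π → validity (completeBipartite p q) π ≡ wordValidity w
numberingWithWord p q w refl count≡p with sorting w
... | σ , sorts = flip σ , trans (validity-completeBipartite p q (flip σ))
  (wordValidity-cong λ k → trans (cong (λ c → inA c (σ ⟨$⟩ʳ k)) (≡.sym count≡p)) (sorts k))

isPhiMax-completeBipartite : ∀ p q → p ≤ q → IsPhiMax (completeBipartite p q) (p * (q C 2))
isPhiMax-completeBipartite p q p≤q with numberingWithWord p q (inA p) refl (count-inA p q)
... | π₀ , π₀-validity =
  (π₀ , trans π₀-validity (trans (wordValidity-inA p q) (cong (p *_) (choose2≡C2 q)))) , bounded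
  where
  open ≤-Reasoning
  bounded : ∀ π → validity (completeBipartite p q) π ≤ p * (q C 2)
  bounded π with count-partWord p q π
  ... | trues , falses = begin
    validity (completeBipartite p q) π  ≡⟨ validity-completeBipartite p q π ⟩
    wordValidity (partWord p π)         ≤⟨ wordValidity≤upperBound (partWord p π) ⟩
    upperBound (count (partWord p π)) (count (not ∘ partWord p π))
                                        ≡⟨ cong₂ upperBound trues falses ⟩
    upperBound p q                      ≡⟨ upperBound-≤ p≤q ⟩
    p * choose2 q                       ≡⟨ cong (p *_) (choose2≡C2 q) ⟩
    p * (q C 2)                         ∎

isPhiMin-completeBipartite : ∀ p d → IsPhiMin (completeBipartite p (p + d)) (sixφmin p d / 6)
isPhiMin-completeBipartite p d
  with numberingWithWord p (p + d) (minimiser p d) (length-minimiser p d) (count-minimiser p d)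
... | π₀ , π₀-validity = (π₀ , trans π₀-validity (≡.sym sixφmin/6)) , bounded
  where
  v = wordValidity (minimiser p d)
  sixφmin/6 : sixφmin p d / 6 ≡ v
  sixφmin/6 = trans (cong (_/ 6) (trans (≡.sym (wordValidity-minimiser p d)) (*-comm 6 v))) (m*n/n≡m v 6)
  bounded : ∀ π → sixφmin p d / 6 ≤ validity (completeBipartite p (p + d)) π
  bounded π with count-partWord p (p + d) π
  ... | trues , falses = *-cancelˡ-≤ 6 (begin
    6 * (sixφmin p d / 6)                ≡⟨ cong (6 *_) sixφmin/6 ⟩
    6 * v                                ≡⟨ wordValidity-minimiser p d ⟩
    sixφmin p d                          ≡⟨ ≡.sym (lowerBound-+ p d) ⟩
    lowerBound p (p + d)                 ≡⟨ ≡.sym (cong₂ lowerBound trues falses) ⟩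
    lowerBound (count (partWord p π)) (count (not ∘ partWord p π))
                                         ≤⟨ lowerBound≤wordValidity (partWord p π) ⟩
    6 * wordValidity (partWord p π)      ≡⟨ cong (6 *_) (≡.sym (validity-completeBipartite p (p + d) π)) ⟩
    6 * validity (completeBipartite p (p + d)) π ∎)
    where open ≤-Reasoning

φmax-formula : ∀ p q → p * (q C 2) ≡ (p * (q * q ∸ q)) / 2
φmax-formula p q = ≡.sym (begin
  (p * (q * q ∸ q)) / 2              ≡⟨ cong (λ s → (p * (s ∸ q)) / 2) (≡.sym (choose2-square q)) ⟩
  (p * (2 * choose2 q + q ∸ q)) / 2  ≡⟨ cong (λ s → (p * s) / 2) (m+n∸n≡m (2 * choose2 q) q) ⟩
  (p * (2 * choose2 q)) / 2          ≡⟨ cong (_/ 2) (ring p (choose2 q)) ⟩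
  (p * choose2 q * 2) / 2            ≡⟨ m*n/n≡m (p * choose2 q) 2 ⟩
  p * choose2 q                      ≡⟨ cong (p *_) (choose2≡C2 q) ⟩
  p * (q C 2)                        ∎)
  where
  open ≡-Reasoning
  ring : ∀ x y → x * (2 * y) ≡ x * y * 2
  ring = solve-∀

φmin-formula : ∀ p d → sixφmin p d ≡ (3 * (p + d) ∸ p ∸ 1) * (p * p ∸ p)
φmin-formula zero    d = ≡.sym (*-zeroʳ (3 * d ∸ 1))
φmin-formula (suc m) d = ≡.sym (begin
  (3 * (suc m + d) ∸ suc m ∸ 1) * (suc m * suc m ∸ suc m)
    ≡⟨ cong₂ (λ x y → (x ∸ suc m ∸ 1) * (y ∸ suc m)) (ring₁ m d) (ring₂ m) ⟩
  (suc (suc (2 * m + 3 * d)) + suc m ∸ suc m ∸ 1) * (suc m * m + suc m ∸ suc m)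
    ≡⟨ cong₂ (λ x y → (x ∸ 1) * y) (m+n∸n≡m (suc (suc (2 * m + 3 * d))) (suc m))
                                    (m+n∸n≡m (suc m * m) (suc m)) ⟩
  suc (2 * m + 3 * d) * (suc m * m)
    ≡⟨ *-comm (suc (2 * m + 3 * d)) (suc m * m) ⟩
  sixφmin (suc m) d ∎)
  where
  open ≡-Reasoning
  ring₁ : ∀ m d → 3 * (suc m + d) ≡ suc (suc (2 * m + 3 * d)) + suc m
  ring₁ = solve-∀
  ring₂ : ∀ m → suc m * suc m ≡ suc m * m + suc m
  ring₂ = solve-∀

lemma5 : ∀ (p q : ℕ) → 1 ≤ p → p ≤ q →
    (IsPhiMax (completeBipartite p q) (p * (q C 2))
      × p * (q C 2) ≡ (p * (q * q ∸ q)) / 2)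
    × IsPhiMin (completeBipartite p q) (((3 * q ∸ p ∸ 1) * (p * p ∸ p)) / 6)
lemma5 p q _ p≤q with m≤n⇒∃[o]m+o≡n p≤q
... | d , refl =
  (isPhiMax-completeBipartite p (p + d) p≤q , φmax-formula p (p + d)) ,
  subst (λ m → IsPhiMin (completeBipartite p (p + d)) (m / 6)) (φmin-formula p d)
        (isPhiMin-completeBipartite p d)
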